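{- Let $k\geq 3$ and $n$ be positive integers and let $a_1<a_2<\cdots<a_k$ be positive integers satisfying $\frac{n}{2^{n}}=\sum_{i=1}^{k}\frac{a_{i}}{2^{a_{i}}}$. Then for every $i$ with $1\leq i\leq k-2$, $$2^{a_k-a_i}\leq \left(a_{i+2}\cdot a_{i+3}\cdots a_{k-1}\cdot a_k\right)\cdot a_k .$$
   Context: The equation $\frac{n}{2^{n}}=\sum_{i=1}^{k}\frac{a_{i}}{2^{a_{i}}}$ is considered in positive integers $n,k,a_1,\ldots,a_k$ with $k\geq 2$ and $a_1<\cdots<a_k$. -}

module Defs where

open import Data.Nat using (ℕ; zero; suc; _^_; _*_; _≤_)
open import Data.Nat.Properties using (m^n≢0)
open import Data.Integer using (+_)
open import Data.Rational using (ℚ; _/_; 0ℚ; _+_)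
open import Data.Fin using (Fin; toℕ)
open import Data.Bool using (if_then_else_)
open import Relation.Nullary.Decidable using (⌊_⌋)
open import Data.Nat using (_≤?_)

term : ℕ → ℚ
term m = _/_ (+ m) (2 ^ m) {{m^n≢0 2 m}}

sumFin : (k : ℕ) → (Fin k → ℚ) → ℚ
sumFin zero    f = 0ℚ
sumFin (suc k) f = f Fin.zero + sumFin k (λ j → f (Fin.suc j))
  where import Data.Fin as Fin

-- product of a j over those j : Fin k with lo ≤ toℕ j
prodFrom : (k : ℕ) → ℕ → (Fin k → ℕ) → ℕ
prodFrom zero    lo a = 1
prodFrom (suc k) lo a =
  (if ⌊ lo ≤? 0 ⌋ then a Fin.zero else 1) * prodFrom k (pred lo) (λ j → a (Fin.suc j))
  where import Data.Fin as Fin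
        pred : ℕ → ℕ
        pred zero = zero
        pred (suc n) = n

-- Multiplying by 2^M with M = n + a_k turns the equation into the identity
-- n·2^(M-n) = Σ_j a_j·2^(M-a_j) in ℕ.  As x/2^x is non-increasing, n ≤ a_1, so
-- 2^(M-a_1) divides the whole sum, hence its tail after a_1, which is therefore
-- at least 2^(M-a_1); since the a_j increase, the same holds for every a_i and
-- the tail after it.  Absorbing each term into the next (a_j·T + T ≤ a_{j+1}·T,
-- with T the tail after a_j) bounds the tail after a_i by
-- 2^(M-a_k)·a_{i+2}⋯a_k·a_k, and dividing by 2^(M-a_k) gives the claim.
module Submission where

open import Defs
open import Data.Nat using (ℕ; zero; suc; pred; _<_; _≤_; _^_; _*_; _∸_; _+_; z≤n; s≤s; >-nonZero)
open import Data.Nat.Properties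
open import Data.Nat.Divisibility using (_∣_; divides; ∣⇒≤; ∣m+n∣m⇒∣n; n∣m*n; ∣-trans)
open import Algebra.Properties.Monoid.Sum +-0-monoid using (sum)
open import Algebra.Properties.CommutativeSemigroup *-commutativeSemigroup using (x∙yz≈y∙xz)
open import Data.Fin using (Fin; toℕ; fromℕ; zero; suc)
open import Data.Vec.Functional using (head; tail)
import Data.Integer as ℤ
import Data.Integer.Properties as ℤₚ
open import Data.Rational as ℚ using (ℚ; toℚᵘ)
import Data.Rational.Properties as ℚₚ
open import Data.Rational.Unnormalised as ℚᵘ using (ℚᵘ; mkℚᵘ; _≃_; *≡*)
import Data.Rational.Unnormalised.Properties as ℚᵘₚ
open import Function using (_∘_)
open import Relation.Binary.PropositionalEquality using (_≡_; refl; sym; trans; cong; cong₂; subst; module ≡-Reasoning)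

m+n≤2^n*m : ∀ {m} n → 0 < m → m + n ≤ 2 ^ n * m
m+n≤2^n*m {m} zero    _   = ≤-reflexive (trans (+-identityʳ m) (sym (*-identityˡ m)))
m+n≤2^n*m {m} (suc n) 0<m = begin
  m + suc n              ≡⟨ +-suc m n ⟩
  1 + (m + n)            ≤⟨ +-mono-≤ (*-mono-≤ (m^n>0 2 n) 0<m) IH ⟩
  2 ^ n * m + 2 ^ n * m  ≡⟨ cong ((2 ^ n * m) +_) (sym (+-identityʳ _)) ⟩
  2 * (2 ^ n * m)        ≡⟨ sym (*-assoc 2 (2 ^ n) m) ⟩
  2 ^ suc n * m          ∎
  where
  open ≤-Reasoning
  IH = m+n≤2^n*m n 0<m

[o∸n]+[n∸m]≡o∸m : ∀ {m n o} → m ≤ n → n ≤ o → (o ∸ n) + (n ∸ m) ≡ o ∸ m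
[o∸n]+[n∸m]≡o∸m {m} {n} {o} m≤n n≤o =
  trans (sym (+-∸-assoc (o ∸ n) m≤n)) (cong (_∸ m) (m∸n+n≡m n≤o))

b^[o∸n]*b^[n∸m]≡b^[o∸m] : ∀ b {m n o} → m ≤ n → n ≤ o → b ^ (o ∸ n) * b ^ (n ∸ m) ≡ b ^ (o ∸ m)
b^[o∸n]*b^[n∸m]≡b^[o∸m] b {m} {n} {o} m≤n n≤o =
  trans (sym (^-distribˡ-+-* b (o ∸ n) (n ∸ m))) (cong (b ^_) ([o∸n]+[n∸m]≡o∸m m≤n n≤o))

2^-mono-∣ : ∀ {m n} → m ≤ n → 2 ^ m ∣ 2 ^ n
2^-mono-∣ {m} {n} m≤n = divides (2 ^ (n ∸ m))
  (trans (cong (2 ^_) (sym (m∸n+n≡m m≤n))) (^-distribˡ-+-* 2 (n ∸ m) m))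

Increasing : ∀ {m} → (Fin m → ℕ) → Set
Increasing g = ∀ i j → toℕ i < toℕ j → g i < g j

Increasing-tail : ∀ {m} {g : Fin (suc m) → ℕ} → Increasing g → Increasing (tail g)
Increasing-tail inc i j i<j = inc (suc i) (suc j) (s≤s i<j)

head<second : ∀ {m} {g : Fin (suc (suc m)) → ℕ} → Increasing g → head g < g (suc zero)
head<second inc = inc zero (suc zero) (s≤s z≤n)

≤-last : ∀ {m} (g : Fin (suc m) → ℕ) → Increasing g → ∀ j → g j ≤ g (fromℕ m)
≤-last {zero}  g inc zero    = ≤-refl
≤-last {suc m} g inc zero    = <⇒≤ (inc zero (fromℕ (suc m)) (s≤s z≤n))
≤-last {suc m} g inc (suc j) = ≤-last (tail g) (Increasing-tail inc) j

prodFrom-suc : ∀ k lo (g : Fin (suc k) → ℕ) → prodFrom (suc k) (suc lo) g ≡ prodFrom k lo (tail g)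
prodFrom-suc k lo g = *-identityˡ _

module _ (M : ℕ) where

  -- 2^M · x/2^x; this is exact only when x ≤ M, since ∸ truncates.
  weight : ℕ → ℕ
  weight x = x * 2 ^ (M ∸ x)

  weight-pos : ∀ {x} → 0 < x → 0 < weight x
  weight-pos {x} 0<x = *-mono-≤ 0<x (m^n>0 2 (M ∸ x))

  weight-antitone : ∀ {x y} → 0 < x → x ≤ y → y ≤ M → weight y ≤ weight x
  weight-antitone {x} {y} 0<x x≤y y≤M = begin
    y * 2 ^ (M ∸ y)                        ≡⟨ *-comm y _ ⟩
    2 ^ (M ∸ y) * y                        ≡⟨ cong (2 ^ (M ∸ y) *_) (sym (m+[n∸m]≡n x≤y)) ⟩
    2 ^ (M ∸ y) * (x + (y ∸ x))            ≤⟨ *-monoʳ-≤ (2 ^ (M ∸ y)) (m+n≤2^n*m (y ∸ x) 0<x) ⟩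
    2 ^ (M ∸ y) * (2 ^ (y ∸ x) * x)        ≡⟨ sym (*-assoc (2 ^ (M ∸ y)) _ x) ⟩
    2 ^ (M ∸ y) * 2 ^ (y ∸ x) * x          ≡⟨ cong (_* x) (b^[o∸n]*b^[n∸m]≡b^[o∸m] 2 x≤y y≤M) ⟩
    2 ^ (M ∸ x) * x                        ≡⟨ *-comm _ x ⟩
    x * 2 ^ (M ∸ x)                        ∎
    where open ≤-Reasoning

  head-weight<sum : ∀ {m} (g : Fin (suc (suc m)) → ℕ) → 0 < g (suc zero) →
                    weight (head g) < sum (weight ∘ g)
  head-weight<sum g 0<g₁ = m<m+n (weight (head g)) (≤-trans (weight-pos 0<g₁) (m≤m+n _ _))

  HeadPowerDivides : ∀ {m} → (Fin (suc m) → ℕ) → Set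
  HeadPowerDivides g = 2 ^ (M ∸ head g) ∣ sum (weight ∘ g)

  weight≡sum⇒≤head : ∀ {n m} (g : Fin (suc (suc m)) → ℕ) → Increasing g → 0 < head g → n ≤ M →
                     weight n ≡ sum (weight ∘ g) → n ≤ head g
  weight≡sum⇒≤head g inc 0<g₀ n≤M eq = ≮⇒≥ λ g₀<n →
    <⇒≱ (subst (weight (head g) <_) (sym eq) (head-weight<sum g 0<g₁)) (weight-antitone 0<g₀ (<⇒≤ g₀<n) n≤M)
    where 0<g₁ = ≤-trans 0<g₀ (<⇒≤ (head<second inc))

  weight≡sum⇒HeadPowerDivides : ∀ {n m} (g : Fin (suc m) → ℕ) → n ≤ head g →
                                weight n ≡ sum (weight ∘ g) → HeadPowerDivides g
  weight≡sum⇒HeadPowerDivides {n} g n≤g₀ eq =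
    subst (2 ^ (M ∸ head g) ∣_) eq (∣-trans (2^-mono-∣ (∸-monoʳ-≤ M n≤g₀)) (n∣m*n n))

  head-power∣tail : ∀ {m} (g : Fin (suc m) → ℕ) → HeadPowerDivides g →
                    2 ^ (M ∸ head g) ∣ sum (weight ∘ tail g)
  head-power∣tail g d = ∣m+n∣m⇒∣n d (n∣m*n (head g))

  HeadPowerDivides-tail : ∀ {m} (g : Fin (suc (suc m)) → ℕ) → Increasing g →
                          HeadPowerDivides g → HeadPowerDivides (tail g)
  HeadPowerDivides-tail g inc d =
    ∣-trans (2^-mono-∣ (∸-monoʳ-≤ M (<⇒≤ (head<second inc)))) (head-power∣tail g d)

  head-power≤tail : ∀ {m} (g : Fin (suc (suc m)) → ℕ) → Increasing g →
                    HeadPowerDivides g → 2 ^ (M ∸ head g) ≤ sum (weight ∘ tail g)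
  head-power≤tail g inc d = ∣⇒≤ {{>-nonZero tail-pos}} (head-power∣tail g d)
    where
    tail-pos : 0 < sum (weight ∘ tail g)
    tail-pos = ≤-trans (weight-pos (≤-trans (s≤s z≤n) (head<second inc))) (m≤m+n _ _)

  sum-weight≤ : ∀ {m} (g : Fin (suc m) → ℕ) → Increasing g → HeadPowerDivides g →
                sum (weight ∘ g) ≤ 2 ^ (M ∸ g (fromℕ m)) * (prodFrom m 0 (tail g) * g (fromℕ m))
  sum-weight≤ {zero} g inc d = ≤-reflexive (begin
    weight g₀ + 0            ≡⟨ +-identityʳ _ ⟩
    g₀ * 2 ^ (M ∸ g₀)        ≡⟨ *-comm g₀ _ ⟩
    2 ^ (M ∸ g₀) * g₀        ≡⟨ cong (2 ^ (M ∸ g₀) *_) (sym (*-identityˡ g₀)) ⟩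
    2 ^ (M ∸ g₀) * (1 * g₀)  ∎)
    where
    open ≡-Reasoning
    g₀ = head g
  sum-weight≤ {suc m} g inc d = begin
    weight g₀ + T            ≤⟨ +-monoˡ-≤ T (*-monoʳ-≤ g₀ (head-power≤tail g inc d)) ⟩
    g₀ * T + T               ≡⟨ +-comm (g₀ * T) T ⟩
    suc g₀ * T               ≤⟨ *-monoˡ-≤ T (head<second inc) ⟩
    g₁ * T                   ≤⟨ *-monoʳ-≤ g₁ IH ⟩
    g₁ * (E * (P * L))       ≡⟨ x∙yz≈y∙xz g₁ E (P * L) ⟩
    E * (g₁ * (P * L))       ≡⟨ cong (E *_) (sym (*-assoc g₁ P L)) ⟩
    E * (g₁ * P * L)         ∎
    where
    open ≤-Reasoning
    g₀ = head g
    g₁ = g (suc zero)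
    T = sum (weight ∘ tail g)
    E = 2 ^ (M ∸ g (fromℕ (suc m)))
    P = prodFrom m 0 (tail (tail g))
    L = g (fromℕ (suc m))
    IH : T ≤ E * (P * L)
    IH = sum-weight≤ (tail g) (Increasing-tail inc) (HeadPowerDivides-tail g inc d)

  gap-bound : ∀ {m} (g : Fin (suc m) → ℕ) → Increasing g → g (fromℕ m) ≤ M → HeadPowerDivides g →
              (i : Fin (suc m)) → toℕ i + 2 ≤ m →
              2 ^ (g (fromℕ m) ∸ g i) ≤ prodFrom (suc m) (toℕ i + 2) g * g (fromℕ m)
  gap-bound {zero}     g inc L≤M d zero ()
  gap-bound {suc zero} g inc L≤M d zero (s≤s ())
  gap-bound {suc (suc m)} g inc L≤M d zero _ =
    *-cancelˡ-≤ (2 ^ (M ∸ L)) {{m^n≢0 2 (M ∸ L)}} (begin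
      2 ^ (M ∸ L) * 2 ^ (L ∸ head g)  ≡⟨ b^[o∸n]*b^[n∸m]≡b^[o∸m] 2 (≤-last g inc zero) L≤M ⟩
      2 ^ (M ∸ head g)                ≤⟨ head-power≤tail g inc d ⟩
      sum (weight ∘ tail g)           ≤⟨ sum-weight≤ (tail g) (Increasing-tail inc) (HeadPowerDivides-tail g inc d) ⟩
      2 ^ (M ∸ L) * (P * L)           ≡⟨ cong (λ p → 2 ^ (M ∸ L) * (p * L)) (sym prodFrom-2) ⟩
      2 ^ (M ∸ L) * (prodFrom (suc (suc (suc m))) 2 g * L) ∎)
    where
    open ≤-Reasoning
    L = g (fromℕ (suc (suc m)))
    P = prodFrom (suc m) 0 (tail (tail g))
    prodFrom-2 : prodFrom (suc (suc (suc m))) 2 g ≡ P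
    prodFrom-2 = trans (prodFrom-suc _ 1 g) (prodFrom-suc _ 0 (tail g))
  gap-bound {suc m} g inc L≤M d (suc i) i+2≤m = begin
    2 ^ (L ∸ g (suc i))                             ≤⟨ IH ⟩
    prodFrom (suc m) (toℕ i + 2) (tail g) * L       ≡⟨ cong (_* L) (sym (prodFrom-suc _ (toℕ i + 2) g)) ⟩
    prodFrom (suc (suc m)) (toℕ (suc i) + 2) g * L  ∎
    where
    open ≤-Reasoning
    L = g (fromℕ (suc m))
    IH = gap-bound (tail g) (Increasing-tail inc) L≤M (HeadPowerDivides-tail g inc d) i (≤-pred i+2≤m)

ℕ→ℚᵘ : ℕ → ℚᵘ
ℕ→ℚᵘ x = ℤ.+ x ℚᵘ./ 1

ℕ→ℚᵘ-injective : ∀ {x y} → ℕ→ℚᵘ x ≃ ℕ→ℚᵘ y → x ≡ y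
ℕ→ℚᵘ-injective {x} {y} (*≡* eq) =
  ℤₚ.+-injective (trans (sym (ℤₚ.*-identityʳ (ℤ.+ x))) (trans eq (ℤₚ.*-identityʳ (ℤ.+ y))))

ℕ→ℚᵘ-homo-+ : ∀ x y → ℕ→ℚᵘ x ℚᵘ.+ ℕ→ℚᵘ y ≃ ℕ→ℚᵘ (x + y)
ℕ→ℚᵘ-homo-+ x y = *≡* (begin
  (ℤ.+ x ℤ.* ℤ.+ 1 ℤ.+ ℤ.+ y ℤ.* ℤ.+ 1) ℤ.* ℤ.+ 1  ≡⟨ ℤₚ.*-identityʳ _ ⟩
  ℤ.+ x ℤ.* ℤ.+ 1 ℤ.+ ℤ.+ y ℤ.* ℤ.+ 1              ≡⟨ cong₂ ℤ._+_ (ℤₚ.*-identityʳ (ℤ.+ x)) (ℤₚ.*-identityʳ (ℤ.+ y)) ⟩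
  ℤ.+ x ℤ.+ ℤ.+ y                                  ≡⟨ sym (ℤₚ.pos-+ x y) ⟩
  ℤ.+ (x + y)                                      ≡⟨ sym (ℤₚ.*-identityʳ _) ⟩
  ℤ.+ (x + y) ℤ.* ℤ.+ 1                            ∎)
  where open ≡-Reasoning

toℚᵘ-term : ∀ m → toℚᵘ (term m) ≃ mkℚᵘ (ℤ.+ m) (pred (2 ^ m))
toℚᵘ-term m = ℚᵘₚ.≃-trans (ℚₚ.toℚᵘ-cong term≡) (ℚₚ.toℚᵘ-fromℚᵘ _)
  where
  instance _ = m^n≢0 2 m
  term≡ : term m ≡ ℚ.fromℚᵘ (mkℚᵘ (ℤ.+ m) (pred (2 ^ m)))
  term≡ = ℚₚ./-cong {ℤ.+ m} refl (sym (suc-pred (2 ^ m)))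

toℚᵘ-term*2^M : ∀ {M m} → m ≤ M → toℚᵘ (term m) ℚᵘ.* ℕ→ℚᵘ (2 ^ M) ≃ ℕ→ℚᵘ (weight M m)
toℚᵘ-term*2^M {M} {m} m≤M = ℚᵘₚ.≃-trans (ℚᵘₚ.*-congʳ (toℚᵘ-term m)) (*≡* (begin
  (ℤ.+ m ℤ.* ℤ.+ 2 ^ M) ℤ.* ℤ.+ 1     ≡⟨ ℤₚ.*-identityʳ _ ⟩
  ℤ.+ m ℤ.* ℤ.+ 2 ^ M                  ≡⟨ sym (ℤₚ.pos-* m (2 ^ M)) ⟩
  ℤ.+ (m * 2 ^ M)                      ≡⟨ cong ℤ.+_ m*2^M≡ ⟩
  ℤ.+ (weight M m * suc (d * 1))       ≡⟨ ℤₚ.pos-* (weight M m) (suc (d * 1)) ⟩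
  ℤ.+ weight M m ℤ.* ℤ.+ suc (d * 1)   ∎))
  where
  open ≡-Reasoning
  instance _ = m^n≢0 2 m
  d = pred (2 ^ m)
  m*2^M≡ : m * 2 ^ M ≡ weight M m * suc (d * 1)
  m*2^M≡ = begin
    m * 2 ^ M                          ≡⟨ cong (λ e → m * 2 ^ e) (sym (m∸n+n≡m m≤M)) ⟩
    m * 2 ^ ((M ∸ m) + m)              ≡⟨ cong (m *_) (^-distribˡ-+-* 2 (M ∸ m) m) ⟩
    m * (2 ^ (M ∸ m) * 2 ^ m)          ≡⟨ sym (*-assoc m _ _) ⟩
    weight M m * 2 ^ m                 ≡⟨ cong (λ e → weight M m * e) (sym (suc-pred (2 ^ m))) ⟩
    weight M m * suc d                 ≡⟨ cong (λ e → weight M m * suc e) (sym (*-identityʳ d)) ⟩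
    weight M m * suc (d * 1)           ∎

toℚᵘ-sumFin*c : ∀ c k (f : Fin k → ℚ) (g : Fin k → ℕ) →
                (∀ j → toℚᵘ (f j) ℚᵘ.* ℕ→ℚᵘ c ≃ ℕ→ℚᵘ (g j)) →
                toℚᵘ (sumFin k f) ℚᵘ.* ℕ→ℚᵘ c ≃ ℕ→ℚᵘ (sum g)
toℚᵘ-sumFin*c c zero    f g fg = *≡* refl
toℚᵘ-sumFin*c c (suc k) f g fg = begin
  toℚᵘ (head f ℚ.+ sumFin k (tail f)) ℚᵘ.* C                ≈⟨ ℚᵘₚ.*-congʳ (ℚₚ.toℚᵘ-homo-+ (head f) _) ⟩
  (toℚᵘ (head f) ℚᵘ.+ toℚᵘ (sumFin k (tail f))) ℚᵘ.* C      ≈⟨ ℚᵘₚ.*-distribʳ-+ C (toℚᵘ (head f)) _ ⟩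
  toℚᵘ (head f) ℚᵘ.* C ℚᵘ.+ toℚᵘ (sumFin k (tail f)) ℚᵘ.* C ≈⟨ ℚᵘₚ.+-cong (fg zero) (toℚᵘ-sumFin*c c k (tail f) (tail g) (fg ∘ suc)) ⟩
  ℕ→ℚᵘ (head g) ℚᵘ.+ ℕ→ℚᵘ (sum (tail g))                    ≈⟨ ℕ→ℚᵘ-homo-+ (head g) _ ⟩
  ℕ→ℚᵘ (sum g)                                              ∎
  where
  open ℚᵘₚ.≃-Reasoning
  C = ℕ→ℚᵘ c

cleared-equation : ∀ {M n k} (a : Fin k → ℕ) → n ≤ M → (∀ j → a j ≤ M) →
                   term n ≡ sumFin k (term ∘ a) → weight M n ≡ sum (weight M ∘ a)
cleared-equation {M} {n} {k} a n≤M a≤M eq = ℕ→ℚᵘ-injective (begin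
  ℕ→ℚᵘ (weight M n)                          ≈⟨ ℚᵘₚ.≃-sym (toℚᵘ-term*2^M n≤M) ⟩
  toℚᵘ (term n) ℚᵘ.* ℕ→ℚᵘ (2 ^ M)            ≈⟨ ℚᵘₚ.*-congʳ (ℚₚ.toℚᵘ-cong eq) ⟩
  toℚᵘ (sumFin k (term ∘ a)) ℚᵘ.* ℕ→ℚᵘ (2 ^ M) ≈⟨ toℚᵘ-sumFin*c (2 ^ M) k (term ∘ a) (weight M ∘ a) (toℚᵘ-term*2^M ∘ a≤M) ⟩
  ℕ→ℚᵘ (sum (weight M ∘ a))                  ∎)
  where open ℚᵘₚ.≃-Reasoning

theorem2p3 : (k' n : ℕ) → 2 ≤ k' → 1 ≤ n → (a : Fin (suc k') → ℕ)
    → (∀ j → 1 ≤ a j) → (∀ i j → toℕ i < toℕ j → a i < a j)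
    → term n ≡ sumFin (suc k') (λ j → term (a j))
    → (i : Fin (suc k')) → toℕ i + 2 ≤ k'
    → 2 ^ (a (fromℕ k') ∸ a i) ≤ prodFrom (suc k') (toℕ i + 2) a * a (fromℕ k')
theorem2p3 k'@(suc _) n _ _ a pos inc eq = gap-bound M a inc (m≤n+m L n) head-divides
  where
  L = a (fromℕ k')
  M = n + L
  n≤M = m≤m+n n L
  cleared : weight M n ≡ sum (weight M ∘ a)
  cleared = cleared-equation a n≤M (λ j → ≤-trans (≤-last a inc j) (m≤n+m L n)) eq
  head-divides : HeadPowerDivides M a
  head-divides = weight≡sum⇒HeadPowerDivides M a n≤a₀ cleared
    where n≤a₀ = weight≡sum⇒≤head M a inc (pos zero) n≤M cleared
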